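{- Let $G$ be a connected finite simple graph without isolated vertices. Then Dom has a winning strategy in the Sepy-start Disjoint Domination Game on $G$ even when Sepy is allowed to pass at any of his turns except the first move of the game (and Dom is not allowed to pass).
   Context: For a vertex $v$, $N[v]$ denotes its closed neighborhood. The Disjoint Domination Game on an isolate-free graph $G=(V,E)$: Dom and Sepy alternately choose a previously uncolored vertex $v$ and color it purple or blue (either player may use either color). With $V_p,V_b$ the current color classes, coloring $v$ with $c$ is legal iff $v\notin V_p\cup V_b$ and some $u\in N[v]$ has $N[u]\cap V_c=\emptyset$. The game terminates as soon as either (s) some vertex has its whole closed neighborhood colored with a single color (Sepy wins), or (d) both $V_p$ and $V_b$ are dominating sets of $G$ (Dom wins). In the Sepy-start game Sepy moves first. -}

module Defs where

open import Data.Nat using (ℕ)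
open import Data.Fin using (Fin; _≟_)
open import Data.Bool using (Bool; true; false; if_then_else_)
open import Data.Maybe using (Maybe; just; nothing)
open import Data.Product using (Σ; ∃; _×_; _,_)
open import Data.Sum using (_⊎_)
open import Relation.Nullary using (¬_; does)
open import Relation.Binary.PropositionalEquality using (_≡_)

record Graph (n : ℕ) : Set where
  field
    adj    : Fin n → Fin n → Bool
    sym    : ∀ u v → adj u v ≡ adj v u
    irrefl : ∀ v → adj v v ≡ false
open Graph public

InN : ∀ {n} → Graph n → Fin n → Fin n → Set
InN G v u = (u ≡ v) ⊎ (adj G v u ≡ true)

data Reach {n} (G : Graph n) : Fin n → Fin n → Set where
  here : ∀ {v} → Reach G v v
  step : ∀ {u w v} → adj G u w ≡ true → Reach G w v → Reach G u v

Connected : ∀ {n} → Graph n → Set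
Connected {n} G = ∀ (u v : Fin n) → Reach G u v

IsolateFree : ∀ {n} → Graph n → Set
IsolateFree {n} G = ∀ (v : Fin n) → ∃ λ u → adj G v u ≡ true

data Color : Set where
  purple blue : Color

State : ℕ → Set
State n = Fin n → Maybe Color

NoColorIn : ∀ {n} → Graph n → State n → Color → Fin n → Set
NoColorIn G s c u = ∀ w → InN G u w → ¬ (s w ≡ just c)

Dominating : ∀ {n} → Graph n → State n → Color → Set
Dominating {n} G s c = ∀ (u : Fin n) → ∃ λ w → InN G u w × s w ≡ just c

DomCond : ∀ {n} → Graph n → State n → Set
DomCond G s = ∀ c → Dominating G s c

SepyCond : ∀ {n} → Graph n → State n → Set
SepyCond {n} G s = Σ (Fin n) λ v → Σ Color λ c → ∀ w → InN G v w → s w ≡ just c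

Legal : ∀ {n} → Graph n → State n → Fin n → Color → Set
Legal {n} G s v c = (s v ≡ nothing) × (Σ (Fin n) λ u → InN G v u × NoColorIn G s c u)

update : ∀ {n} → State n → Fin n → Color → State n
update s v c w = if does (w ≟ v) then just c else s w

initial : ∀ {n} → State n
initial _ = nothing

-- Dom has a winning strategy from the given position, with Dom (WinD)
-- resp. Sepy (WinS, Sepy may pass) to move. Inductive: strategies are
-- well-founded, i.e. Dom forces a win in finitely many moves.
mutual
  data WinD {n} (G : Graph n) (s : State n) : Set where
    dWon  : DomCond G s → WinD G s
    dMove : ¬ DomCond G s → ¬ SepyCond G s →
            (v : Fin n) (c : Color) → Legal G s v c →
            WinS G (update s v c) → WinD G s

  data WinS {n} (G : Graph n) (s : State n) : Set where
    sWon  : DomCond G s → WinS G s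
    sTurn : ¬ DomCond G s → ¬ SepyCond G s →
            (∀ (v : Fin n) (c : Color) → Legal G s v c → WinD G (update s v c)) →
            WinD G s →     -- Sepy passes
            WinS G s

-- Sepy's first move of the game (no passing allowed).
WinSFirst : ∀ {n} → Graph n → State n → Set
WinSFirst {n} G s =
  DomCond G s ⊎
  (¬ DomCond G s × ¬ SepyCond G s ×
   (∀ (v : Fin n) (c : Color) → Legal G s v c → WinD G (update s v c)))

DomWinsSepyStartWithPasses : ∀ {n} → Graph n → Set
DomWinsSepyStartWithPasses G = WinSFirst G initial

-- Dom keeps the position balanced: every coloured vertex sees the opposite
-- colour in its closed neighbourhood, so no closed neighbourhood is ever
-- monochromatic. If some colour c fails to dominate a vertex u, Dom colours u
-- with c when u already sees the other colour; otherwise N[u] is entirely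
-- uncoloured, and walking from u towards a coloured vertex (connectivity)
-- reaches an uncoloured vertex x next to a blank neighbourhood that sees some
-- colour d, and Dom colours x with the opposite of d. When Sepy colours v with
-- c without breaking the balance, Dom plays as above; when he breaks it, v has
-- an uncoloured neighbour x (a legal move needs one, as G has no isolated
-- vertices), and Dom colours x with the opposite of c. Each move colours a
-- vertex, so the game ends, and it cannot end with a win for Sepy.
module Submission where

open import Defs hiding (sym)
open import Data.Nat using (ℕ; zero; suc; _+_; _<_)
open import Data.Nat.Properties using (≤-refl; <-trans; +-monoʳ-<)
open import Data.Nat.Induction using (<-wellFounded)
open import Data.Fin using (Fin; zero; suc; _≟_)
open import Data.Fin.Properties using (any?; all?; ¬∀⟶∃¬)
open import Data.Bool using (true)
import Data.Bool.Properties as Bool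
open import Data.Maybe using (Maybe; just; nothing)
open import Data.Maybe.Properties as Maybe using (just-injective)
open import Data.Product using (∃; _×_; _,_; proj₁)
open import Data.Sum using (_⊎_; inj₁; inj₂)
open import Data.Empty using (⊥; ⊥-elim)
open import Induction.WellFounded using (Acc; acc)
open import Relation.Nullary using (¬_; Dec; yes; no)
open import Relation.Nullary.Decidable using (_×-dec_; _⊎-dec_; _→-dec_)
open import Relation.Binary.Definitions using (DecidableEquality)
open import Relation.Binary.PropositionalEquality
  using (_≡_; _≢_; refl; sym; trans; cong; subst)

opposite : Color → Color
opposite purple = blue
opposite blue   = purple

opposite-involutive : ∀ c → opposite (opposite c) ≡ c
opposite-involutive purple = refl
opposite-involutive blue   = refl

opposite-≢ : ∀ c → opposite c ≢ c
opposite-≢ purple ()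
opposite-≢ blue   ()

≡-or-≡opposite : ∀ d c → d ≡ c ⊎ d ≡ opposite c
≡-or-≡opposite purple purple = inj₁ refl
≡-or-≡opposite purple blue   = inj₂ refl
≡-or-≡opposite blue   purple = inj₂ refl
≡-or-≡opposite blue   blue   = inj₁ refl

_≟ᶜ_ : DecidableEquality Color
purple ≟ᶜ purple = yes refl
purple ≟ᶜ blue   = no λ ()
blue   ≟ᶜ purple = no λ ()
blue   ≟ᶜ blue   = yes refl

update-≡ : ∀ {n} (s : State n) v c → update s v c v ≡ just c
update-≡ s v c with v ≟ v
... | yes _  = refl
... | no v≢v = ⊥-elim (v≢v refl)

update-≢ : ∀ {n} (s : State n) {v w} c → w ≢ v → update s v c w ≡ s w
update-≢ s {v} {w} c w≢v with w ≟ v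
... | yes w≡v = ⊥-elim (w≢v w≡v)
... | no _    = refl

update-inv : ∀ {n} (s : State n) v w {c d} → update s v c w ≡ just d →
             (w ≡ v × d ≡ c) ⊎ s w ≡ just d
update-inv s v w eq with w ≟ v
... | yes w≡v = inj₁ (w≡v , sym (just-injective eq))
... | no _    = inj₂ eq

_⊑_ : ∀ {n} → State n → State n → Set
s ⊑ t = ∀ w {d} → s w ≡ just d → t w ≡ just d

⊑-trans : ∀ {n} {s t u : State n} → s ⊑ t → t ⊑ u → s ⊑ u
⊑-trans s⊑t t⊑u w eq = t⊑u w (s⊑t w eq)

⊑-update : ∀ {n} {s : State n} {v} c → s v ≡ nothing → s ⊑ update s v c
⊑-update {s = s} {v} c sv w eq with w ≟ v
... | yes refl = ⊥-elim (nothing≢just (trans (sym sv) eq))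
  where nothing≢just : ∀ {d : Color} → nothing ≢ just d
        nothing≢just ()
... | no _     = eq

uncolouredAt : Maybe Color → ℕ
uncolouredAt nothing  = 1
uncolouredAt (just _) = 0

#uncoloured : ∀ {n} → State n → ℕ
#uncoloured {zero}  s = 0
#uncoloured {suc n} s = uncolouredAt (s zero) + #uncoloured (λ i → s (suc i))

#uncoloured-update : ∀ {n} (s : State n) {v} c → s v ≡ nothing →
                     #uncoloured (update s v c) < #uncoloured s
#uncoloured-update {suc n} s {zero}  c sv rewrite sv = ≤-refl
#uncoloured-update {suc n} s {suc v} c sv =
  +-monoʳ-< (uncolouredAt (s zero)) (#uncoloured-update (λ i → s (suc i)) c sv)

module Strategy {n : ℕ} (G : Graph n) where

  adj-sym : ∀ {u v} → adj G u v ≡ true → adj G v u ≡ true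
  adj-sym {u} {v} uv = trans (Graph.sym G v u) uv

  adj⇒≢ : ∀ {u v} → adj G u v ≡ true → v ≢ u
  adj⇒≢ {u} uv refl with trans (sym uv) (Graph.irrefl G u)
  ... | ()

  inN? : ∀ v u → Dec (InN G v u)
  inN? v u = (u ≟ v) ⊎-dec (adj G v u Bool.≟ true)

  Sees : State n → Fin n → Color → Set
  Sees s u c = ∃ λ w → InN G u w × s w ≡ just c

  Blank : State n → Fin n → Set
  Blank s u = ∀ w → InN G u w → s w ≡ nothing

  Balanced : State n → Set
  Balanced s = ∀ w {c} → s w ≡ just c → Sees s w (opposite c)

  Coloured : State n → Set
  Coloured s = ∃ λ w → ∃ λ c → s w ≡ just c

  sees? : ∀ s u c → Dec (Sees s u c)
  sees? s u c = any? λ w → inN? u w ×-dec Maybe.≡-dec _≟ᶜ_ (s w) (just c)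

  blank? : ∀ s u → Dec (Blank s u)
  blank? s u = all? λ w → inN? u w →-dec Maybe.≡-dec _≟ᶜ_ (s w) nothing

  sees-⊑ : ∀ {s t u c} → s ⊑ t → Sees s u c → Sees t u c
  sees-⊑ s⊑t (w , uw , sw) = w , uw , s⊑t w sw

  blank⇒¬sees : ∀ {s u c} → Blank s u → ¬ Sees s u c
  blank⇒¬sees blank (w , uw , sw) with trans (sym (blank w uw)) sw
  ... | ()

  ¬blank⇒sees : ∀ {s u} → ¬ Blank s u → ∃ λ d → Sees s u d
  ¬blank⇒sees {s} {u} ¬blank
    with ¬∀⟶∃¬ n _ (λ w → inN? u w →-dec Maybe.≡-dec _≟ᶜ_ (s w) nothing) ¬blank
  ... | w , ¬uw⇒sw with inN? u w | s w in sw
  ...   | yes uw | just d  = d , w , uw , sw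
  ...   | yes _  | nothing = ⊥-elim (¬uw⇒sw λ _ → refl)
  ...   | no ¬uw | _       = ⊥-elim (¬uw⇒sw λ uw → ⊥-elim (¬uw uw))

  ¬sees-both⇒blank : ∀ {s u c} → ¬ Sees s u c → ¬ Sees s u (opposite c) → Blank s u
  ¬sees-both⇒blank {s} {u} {c} ¬c ¬c′ w uw with s w in sw
  ... | nothing = refl
  ... | just d with ≡-or-≡opposite d c
  ...   | inj₁ refl = ⊥-elim (¬c  (w , uw , sw))
  ...   | inj₂ refl = ⊥-elim (¬c′ (w , uw , sw))

  dominating? : ∀ s c → Dec (Dominating G s c)
  dominating? s c = all? λ u → sees? s u c

  domCond? : ∀ s → Dec (DomCond G s)
  domCond? s with dominating? s purple | dominating? s blue
  ... | yes p  | yes b = yes λ { purple → p ; blue → b }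
  ... | no ¬p  | _     = no λ dom → ¬p (dom purple)
  ... | yes _  | no ¬b = no λ dom → ¬b (dom blue)

  ¬domCond⇒unseen : ∀ {s} → ¬ DomCond G s → ∃ λ c → ∃ λ u → ¬ Sees s u c
  ¬domCond⇒unseen {s} ¬dom with dominating? s purple | dominating? s blue
  ... | yes p | yes b = ⊥-elim (¬dom λ { purple → p ; blue → b })
  ... | no ¬p | _     = purple , ¬∀⟶∃¬ n _ (λ u → sees? s u purple) ¬p
  ... | yes _ | no ¬b = blue   , ¬∀⟶∃¬ n _ (λ u → sees? s u blue)   ¬b

  sepyCond-⊑ : ∀ {s t} → s ⊑ t → SepyCond G s → SepyCond G t
  sepyCond-⊑ s⊑t (v , c , mono) = v , c , λ w vw → s⊑t w (mono w vw)

  balanced⇒¬sepyCond : ∀ {s} → Balanced s → ¬ SepyCond G s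
  balanced⇒¬sepyCond bal (v , c , mono) with bal v (mono v (inj₁ refl))
  ... | w , vw , sw = opposite-≢ c (just-injective (trans (sym sw) (mono w vw)))

  legal : ∀ {s v u c} → s v ≡ nothing → InN G v u → ¬ Sees s u c → Legal G s v c
  legal sv vu ¬sees = sv , _ , vu , λ w uw sw → ¬sees (w , uw , sw)

  balanced-initial : Balanced initial
  balanced-initial w ()

  balanced-update : ∀ {s v c} → Balanced s → s v ≡ nothing → Sees s v (opposite c) →
                    Balanced (update s v c)
  balanced-update {s} {v} {c} bal sv sees w tw with update-inv s v w tw
  ... | inj₁ (refl , refl) = sees-⊑ (⊑-update c sv) sees
  ... | inj₂ sw            = sees-⊑ (⊑-update c sv) (bal w sw)

  balanced-updatePair : ∀ {s v x} c → Balanced s → adj G v x ≡ true →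
                        s v ≡ nothing → s x ≡ nothing →
                        Balanced (update (update s v c) x (opposite c))
  balanced-updatePair {s} {v} {x} c bal vx sv sx w t₂w with update-inv (update s v c) x w t₂w
  ... | inj₁ (refl , refl) =
    v , inj₂ (adj-sym vx) ,
    trans (trans (update-≢ (update s v c) (opposite c) (adj⇒≢ (adj-sym vx))) (update-≡ s v c))
          (cong just (sym (opposite-involutive c)))
  ... | inj₂ tw with update-inv s v w tw
  ...   | inj₁ (refl , refl) = x , inj₂ vx , update-≡ (update s v c) x (opposite c)
  ...   | inj₂ sw =
    sees-⊑ (⊑-trans (⊑-update c sv) (⊑-update _ (trans (update-≢ s c (adj⇒≢ vx)) sx)))
           (bal w sw)

  ¬sees⇒uncoloured : ∀ {s u c} → Balanced s → ¬ Sees s u c → s u ≡ nothing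
  ¬sees⇒uncoloured {s} {u} {c} bal ¬sees with s u in su
  ... | nothing = refl
  ... | just d with ≡-or-≡opposite d c
  ...   | inj₁ refl = ⊥-elim (¬sees (u , inj₁ refl , su))
  ...   | inj₂ refl = ⊥-elim (¬sees (subst (Sees s u) (opposite-involutive c) (bal u su)))

  frontier : ∀ {s u z e} → Reach G u z → Blank s u → s z ≡ just e →
             ∃ λ x → ∃ λ y → ∃ λ d → adj G y x ≡ true × Blank s y × Sees s x d
  frontier here blank sz = ⊥-elim (blank⇒¬sees blank (_ , inj₁ refl , sz))
  frontier {s} {u} (step {w = x} ux path) blank sz with blank? s x
  ... | yes blank-x = frontier path blank-x sz
  ... | no ¬blank-x with ¬blank⇒sees ¬blank-x
  ...   | d , sees = x , u , d , ux , blank , sees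

  balancedMove : Connected G → ∀ {s} → Balanced s → Coloured s → ¬ DomCond G s →
                 ∃ λ v → ∃ λ c → Legal G s v c × Balanced (update s v c)
  balancedMove conn {s} bal (z , e , sz) ¬dom with ¬domCond⇒unseen ¬dom
  ... | c , u , ¬c with sees? s u (opposite c)
  ...   | yes c′ = u , c , legal su (inj₁ refl) ¬c , balanced-update bal su c′
    where su = ¬sees⇒uncoloured bal ¬c
  ...   | no ¬c′ with frontier (conn u z) (¬sees-both⇒blank ¬c ¬c′) sz
  ...     | x , y , d , yx , blank-y , sees =
    x , opposite d , legal sx (inj₂ (adj-sym yx)) (blank⇒¬sees blank-y) ,
    balanced-update bal sx (subst (Sees s x) (sym (opposite-involutive d)) sees)
    where sx = blank-y x (inj₂ yx)

  -- Were all neighbours of v coloured, they would all have colour c, so every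
  -- vertex of N[v] would see c (v through a neighbour, which exists as G has no
  -- isolated vertices) and colouring v with c would not be legal.
  uncolouredNeighbour : IsolateFree G → ∀ {s v c} → Legal G s v c →
                        ¬ Sees s v (opposite c) →
                        ∃ λ x → adj G v x ≡ true × s x ≡ nothing
  uncolouredNeighbour iso {s} {v} {c} (_ , u , vu , unseen) ¬c′
    with any? (λ x → (adj G v x Bool.≟ true) ×-dec Maybe.≡-dec _≟ᶜ_ (s x) nothing)
  ... | yes found = found
  ... | no none = ⊥-elim (u-sees-c vu)
    where
    neighbour-c : ∀ {y} → adj G v y ≡ true → s y ≡ just c
    neighbour-c {y} vy with s y in sy
    ... | nothing = ⊥-elim (none (y , vy , sy))
    ... | just d with ≡-or-≡opposite d c
    ...   | inj₁ refl = refl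
    ...   | inj₂ refl = ⊥-elim (¬c′ (y , inj₂ vy , sy))

    u-sees-c : InN G v u → ⊥
    u-sees-c (inj₁ refl) = let (y , vy) = iso v in unseen y (inj₂ vy) (neighbour-c vy)
    u-sees-c (inj₂ vu)   = unseen u (inj₁ refl) (neighbour-c vu)

  module _ (conn : Connected G) (iso : IsolateFree G) where

    replyMove : ∀ {s v c} → Balanced s → Legal G s v c → ¬ DomCond G (update s v c) →
                ¬ SepyCond G (update s v c) ×
                (∃ λ x → ∃ λ d → Legal G (update s v c) x d × Balanced (update (update s v c) x d))
    replyMove {s} {v} {c} bal legal-v ¬dom with sees? s v (opposite c)
    ... | yes c′ = balanced⇒¬sepyCond bal′ , balancedMove conn bal′ (v , c , update-≡ s v c) ¬dom
      where bal′ = balanced-update bal (proj₁ legal-v) c′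
    ... | no ¬c′ with uncolouredNeighbour iso legal-v ¬c′
    ...   | x , vx , sx = ¬sepy , x , opposite c , legal tx (inj₂ (adj-sym vx)) ¬sees-v , bal₂
      where
      sv : s v ≡ nothing
      sv = proj₁ legal-v
      tx : update s v c x ≡ nothing
      tx = trans (update-≢ s c (adj⇒≢ vx)) sx
      bal₂ : Balanced (update (update s v c) x (opposite c))
      bal₂ = balanced-updatePair c bal vx sv sx
      ¬sepy : ¬ SepyCond G (update s v c)
      ¬sepy sepy = balanced⇒¬sepyCond bal₂ (sepyCond-⊑ (⊑-update _ tx) sepy)
      ¬sees-v : ¬ Sees (update s v c) v (opposite c)
      ¬sees-v (w , vw , tw) with update-inv s v w tw
      ... | inj₁ (_ , c′≡c) = opposite-≢ c c′≡c
      ... | inj₂ sw         = ¬c′ (w , vw , sw)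

    -- Every move colours a vertex, so the number of uncoloured vertices decreases.
    mutual
      domWinsDomToMove : ∀ {s} → Acc _<_ (#uncoloured s) → Balanced s → Coloured s → WinD G s
      domWinsDomToMove {s} (acc smaller) bal col with domCond? s
      ... | yes dom = dWon dom
      ... | no ¬dom with balancedMove conn bal col ¬dom
      ...   | v , c , legal-v , bal′ =
        dMove ¬dom (balanced⇒¬sepyCond bal) v c legal-v
          (domWinsSepyToMove (smaller (#uncoloured-update s c (proj₁ legal-v)))
                             bal′ (v , c , update-≡ s v c))

      domWinsSepyToMove : ∀ {s} → Acc _<_ (#uncoloured s) → Balanced s → Coloured s → WinS G s
      domWinsSepyToMove {s} rec bal col with domCond? s
      ... | yes dom = sWon dom
      ... | no ¬dom =
        sTurn ¬dom (balanced⇒¬sepyCond bal) (domWinsAfter rec bal) (domWinsDomToMove rec bal col)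

      domWinsAfter : ∀ {s} → Acc _<_ (#uncoloured s) → Balanced s →
                     ∀ v c → Legal G s v c → WinD G (update s v c)
      domWinsAfter {s} (acc smaller) bal v c legal-v with domCond? (update s v c)
      ... | yes dom = dWon dom
      ... | no ¬dom with replyMove bal legal-v ¬dom
      ...   | ¬sepy , x , d , legal-x , bal′ =
        dMove ¬dom ¬sepy x d legal-x
          (domWinsSepyToMove
            (smaller (<-trans (#uncoloured-update (update s v c) d (proj₁ legal-x))
                              (#uncoloured-update s c (proj₁ legal-v))))
            bal′ (x , d , update-≡ (update s v c) x d))

mainTheorem5 : (n : ℕ) (G : Graph n) → Connected G → IsolateFree G →
    DomWinsSepyStartWithPasses G
mainTheorem5 n G conn iso with Strategy.domCond? G initial
... | yes dom = inj₁ dom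
... | no ¬dom =
  inj₂ (¬dom , balanced⇒¬sepyCond balanced-initial ,
        domWinsAfter conn iso (<-wellFounded _) balanced-initial)
  where open Strategy G
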